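{- Let $G$ be an MP-digraph, $M_G$ its multipath matroid, and $e=(v,w)$ an edge of $G$ which is not a loop. Then $M_{G\setminus e}=M_G\setminus e$ and $M_{G/\!\!/ e}=M_G/e$, where the ground set $E(G/\!\!/e)$ is identified with $E(G)\setminus\{e\}$ via the natural correspondence of edges under MP-contraction.
   Context: Digraphs: finite, at most one edge $(v,w)$ from $v$ to $w$ for distinct $v,w$, finitely many loops allowed per vertex. A multipath is a spanning subgraph each of whose connected components is a vertex or a simple path (sequence of non-loop edges, target of each = source of next, no repeated vertex, not closing into a cycle); $M_G=(E(G),\mathrm{Mult}(G))$ with $\mathrm{Mult}(G)$ the multipaths as edge sets. An MP-digraph satisfies (MP1) no subgraph isomorphic to $D_A$ (vertices $v_0,v_1,v_2$, edges $(v_1,v_0),(v_0,v_2),(v_1,v_2)$) or $D_B$ (vertices $v_0,\dots,v_3$, edges $(v_0,v_1),(v_2,v_1),(v_2,v_3)$) or their edge-reversals, and (MP2) every coherently oriented cycle of length $\ge2$ is a connected component; then $M_G$ is a matroid. $G\setminus e$ has the same vertices and edges $E(G)\setminus\{e\}$. The MP-contraction $G/\!\!/e$ of $e=(v,w)$, $v\ne w$: vertices $(V(G)\setminus\{v,w\})\cup\{x\}$ with $x$ new; each edge $(a,b)$ with $a,b\notin\{v,w\}$ is kept; each edge $(a,v)$ becomes $(a,x)$ and each edge $(w,b)$ becomes $(x,b)$; each edge $(v,a)$ with $a\ne w$ and each edge $(b,w)$ with $b\neq v$ becomes a loop at $x$; loops at $v$ or $w$ become loops at $x$ (an edge $(w,v)$,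 if present, becomes a loop at $x$). Matroid deletion $M\setminus e$: ground set $X\setminus\{e\}$, independents those of $M$ not containing $e$. Matroid contraction $M/e$ (for $\{e\}$ independent): ground set $X\setminus\{e\}$, independents those $I$ with $I\cup\{e\}$ independent in $M$. -}

module Defs where

open import Data.Nat using (ℕ; suc; _≥_)
open import Data.Fin using (Fin; _≟_; punchIn; punchOut)
open import Data.Fin.Subset using (Subset; inside; outside) renaming (_∈_ to _∈ₛ_)
open import Data.Vec using (insertAt)
open import Data.Bool using (Bool; true; false; _∨_)
open import Data.List using (List; []; _∷_; map; concat; concatMap; length; _++_; take)
open import Data.List.Membership.Propositional using (_∈_)
open import Data.List.Relation.Unary.All using (All)
open import Data.List.Relation.Unary.Linked using (Linked)
open import Data.List.Relation.Unary.Unique.Propositional using (Unique)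
open import Data.Product using (Σ; ∃; _×_; _,_)
open import Data.Sum using (_⊎_)
open import Function.Bundles using (_⇔_)
open import Relation.Binary.PropositionalEquality using (_≡_; _≢_)
open import Relation.Nullary using (¬_; does)

-- Finite (raw) digraphs: vertices Fin n, edges Fin m (edges have
-- identity, so several loops at a vertex are allowed).

record RawDigraph (n m : ℕ) : Set where
  field
    src : Fin m → Fin n
    tgt : Fin m → Fin n
open RawDigraph public

IsDigraph : ∀ {n m} → RawDigraph n m → Set
IsDigraph G = ∀ f g → src G f ≢ tgt G f →
  src G f ≡ src G g → tgt G f ≡ tgt G g → f ≡ g

HasEdge : ∀ {n m} → RawDigraph n m → Fin n → Fin n → Set
HasEdge {m = m} G a b = Σ (Fin m) λ f → src G f ≡ a × tgt G f ≡ b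

Consecutive : ∀ {n m} → RawDigraph n m → Fin m → Fin m → Set
Consecutive G f g = tgt G f ≡ src G g

pathVerts : ∀ {n m} → RawDigraph n m → List (Fin m) → List (Fin n)
pathVerts G [] = []
pathVerts G (e ∷ es) = src G e ∷ map (tgt G) (e ∷ es)

IsSimplePath : ∀ {n m} → RawDigraph n m → List (Fin m) → Set
IsSimplePath G p = length p ≥ 1 × Linked (Consecutive G) p × Unique (pathVerts G p)

-- A multipath (as an edge set S): the spanning subgraph (V , S) has every
-- connected component an isolated vertex or a simple path; i.e. S is the
-- edge set of a family of pairwise vertex-disjoint simple paths.
IsMultipath : ∀ {n m} → RawDigraph n m → Subset m → Set
IsMultipath {n} {m} G S = Σ (List (List (Fin m))) λ ps →
  All (IsSimplePath G) ps ×
  Unique (concatMap (pathVerts G) ps) ×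
  (∀ f → (f ∈ₛ S) ⇔ (f ∈ concat ps))

IsCycle : ∀ {n m} → RawDigraph n m → List (Fin m) → Set
IsCycle G c = length c ≥ 2 × Linked (Consecutive G) (c ++ take 1 c) ×
  Unique (map (src G) c)

-- the cycle (its vertices and edges) is a connected component of G:
-- every edge incident to a cycle vertex is a cycle edge
IsComponent : ∀ {n m} → RawDigraph n m → List (Fin m) → Set
IsComponent G c = ∀ f → (src G f ∈ map (src G) c ⊎ tgt G f ∈ map (src G) c) → f ∈ c

-- (MP1) no subgraph isomorphic to D_A, D_B or their edge reversals
MP1 : ∀ {n m} → RawDigraph n m → Set
MP1 G =
  (∀ v₀ v₁ v₂ → Unique (v₀ ∷ v₁ ∷ v₂ ∷ []) →
     ¬ (HasEdge G v₁ v₀ × HasEdge G v₀ v₂ × HasEdge G v₁ v₂)) ×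
  (∀ v₀ v₁ v₂ → Unique (v₀ ∷ v₁ ∷ v₂ ∷ []) →
     ¬ (HasEdge G v₀ v₁ × HasEdge G v₂ v₀ × HasEdge G v₂ v₁)) ×
  (∀ v₀ v₁ v₂ v₃ → Unique (v₀ ∷ v₁ ∷ v₂ ∷ v₃ ∷ []) →
     ¬ (HasEdge G v₀ v₁ × HasEdge G v₂ v₁ × HasEdge G v₂ v₃)) ×
  (∀ v₀ v₁ v₂ v₃ → Unique (v₀ ∷ v₁ ∷ v₂ ∷ v₃ ∷ []) →
     ¬ (HasEdge G v₁ v₀ × HasEdge G v₁ v₂ × HasEdge G v₃ v₂))

MP2 : ∀ {n m} → RawDigraph n m → Set
MP2 G = ∀ c → IsCycle G c → IsComponent G c

IsMPDigraph : ∀ {n m} → RawDigraph n m → Set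
IsMPDigraph G = IsDigraph G × MP1 G × MP2 G

-- Set systems (ground set Fin m, independence predicate) and the
-- matroid operations.  Ground set of the minors at e : Fin (suc m) is
-- identified with E \ {e} via punchIn e.

record SetSystem (m : ℕ) : Set₁ where
  field
    Indep : Subset m → Set
open SetSystem public

MultMatroid : ∀ {n m} → RawDigraph n m → SetSystem m
MultMatroid G = record { Indep = IsMultipath G }

_∖ₘ_ : ∀ {m} → SetSystem (suc m) → Fin (suc m) → SetSystem m
M ∖ₘ e = record { Indep = λ I → Indep M (insertAt I e outside) }

_/ₘ_ : ∀ {m} → SetSystem (suc m) → Fin (suc m) → SetSystem m
M /ₘ e = record { Indep = λ I → Indep M (insertAt I e inside) }

_≈ₘ_ : ∀ {m} → SetSystem m → SetSystem m → Set
M ≈ₘ N = ∀ I → Indep M I ⇔ Indep N I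

deleteEdge : ∀ {n m} → RawDigraph n (suc m) → Fin (suc m) → RawDigraph n m
deleteEdge G e = record { src = λ f → src G (punchIn e f)
                        ; tgt = λ f → tgt G (punchIn e f) }

-- vertex map for the MP-contraction of e = (v , w), v ≢ w:
-- V(G//e) = Fin n ≅ (V \ {v , w}) ∪ {x}, where v and w are sent to
-- x := punchOut (v≢w) and every other u to punchOut (v≢u).
mergeV : ∀ {n} (v w : Fin (suc n)) → v ≢ w → Fin (suc n) → Fin n
mergeV v w v≢w u with v ≟ u
... | Relation.Nullary.yes _ = punchOut v≢w
... | Relation.Nullary.no v≢u = punchOut v≢u

-- An edge f ≠ e becomes a loop at x
-- if src f = v or tgt f = w (covers (v,a), (b,w), loops at v or w);
-- otherwise (a , b) ↦ (φ a , φ b) (covers (a,b), (a,v)↦(a,x),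
-- (w,b)↦(x,b), (w,v)↦(x,x)).
contractEdge : ∀ {n m} (G : RawDigraph (suc n) (suc m)) (e : Fin (suc m)) →
  src G e ≢ tgt G e → RawDigraph n m
contractEdge G e nl = record { src = λ f → s' (punchIn e f) ; tgt = λ f → t' (punchIn e f) }
  where
  v = src G e
  w = tgt G e
  φ = mergeV v w nl
  x = punchOut nl
  toX : Fin _ → Bool
  toX g = does (src G g ≟ v) ∨ does (tgt G g ≟ w)
  s' : Fin _ → Fin _
  s' g with toX g
  ... | true = x
  ... | false = φ (src G g)
  t' : Fin _ → Fin _
  t' g with toX g
  ... | true = x
  ... | false = φ (tgt G g)

{-# OPTIONS --safe #-}
-- An edge set is a multipath exactly when it is a linear forest: no two of its
-- edges share a source or a target, and some height function on the vertices
-- strictly increases along its edges. One direction takes positions in the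
-- vertex list of the paths as heights; for the other, the edges are assembled
-- into paths in order of decreasing source height. Being a linear forest is a
-- local condition, so it transfers directly along both minors. Deleting an
-- edge outside the set changes nothing. If I ∪ {e} is a linear forest with
-- e = (v, w), then no edge of I leaves v or enters w, so these edges survive
-- the contraction as non-loops with merged endpoints. Heights move from G to
-- G//e along the section punchIn v of the merge map, and back by doubling and
-- placing w just above v.
module Submission where

open import Defs
open import Data.Nat using (ℕ; suc; _<_; _≤_; _*_; z≤n; s≤s)
import Data.Nat.Properties as ℕ
open import Data.Fin using (Fin; punchIn; punchOut; _≟_)
import Data.Fin.Properties as Fin
open import Data.Fin.Subset using (Subset; inside; outside) renaming (_∈_ to _∈ₛ_; _∉_ to _∉ₛ_)
import Data.Fin.Subset.Properties as Subset
open import Data.List using (List; []; _∷_; [_]; _++_; map; concat; filter; allFin)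
import Data.List.Properties as List
open import Data.List.Membership.Propositional using (_∈_; _∉_)
open import Data.List.Membership.Propositional.Properties
  using (∈-map⁺; ∈-map⁻; ∈-++⁺ˡ; ∈-++⁺ʳ; ∈-++⁻; ∈-concat⁺′; ∈-concat⁻′; ∈-filter⁺; ∈-filter⁻; ∈-allFin)
open import Data.List.Relation.Unary.Any using (here; there)
open import Data.List.Relation.Unary.All as All using (All; []; _∷_)
open import Data.List.Relation.Unary.All.Properties using (¬Any⇒All¬)
open import Data.List.Relation.Unary.AllPairs using (AllPairs; []; _∷_)
open import Data.List.Relation.Unary.Linked using (Linked; []; [-]; _∷_)
open import Data.List.Relation.Unary.Linked.Properties using (Linked⇒AllPairs)
open import Data.List.Relation.Unary.Unique.Propositional using (Unique)
import Data.List.Relation.Unary.Unique.Propositional.Properties as Unique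
open import Data.List.Relation.Binary.Permutation.Propositional using (_↭_; refl; prep; swap; trans; ↭-sym; ↭⇒↭ₛ)
import Data.List.Relation.Binary.Permutation.Propositional.Properties as ↭
import Data.List.Relation.Binary.Permutation.Setoid.Properties as ↭ₛ
open import Data.List.Relation.Binary.Sublist.Propositional using (_⊆_; []; _∷_; _∷ʳ_; ⊆-refl)
open import Data.List.Relation.Binary.Sublist.Propositional.Properties using (All-resp-⊆; ++⁺)
import Data.List.Sort as Sort
open import Data.Vec using (insertAt)
import Data.Vec.Properties as Vec
open import Data.Product using (∃; ∃₂; _×_; _,_; proj₁; proj₂)
open import Data.Sum using (_⊎_; inj₁; inj₂)
open import Function using (_∘_)
open import Function.Bundles using (_⇔_; mk⇔; Equivalence)
import Function.Properties.Equivalence as ⇔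
open import Level using (0ℓ)
open import Relation.Binary.Definitions using (DecidableEquality)
import Relation.Binary.Construct.On as On
import Relation.Binary.Reasoning.Setoid as SetoidReasoning
open import Relation.Binary.PropositionalEquality using (_≡_; _≢_; refl; sym; cong; subst; setoid)
import Relation.Binary.PropositionalEquality as ≡
open import Relation.Nullary using (¬_; yes; no; contradiction)
open import Relation.Unary using (Pred)

private variable
  A B : Set
  x y : A
  xs ys : List A

Unique-∷ : x ∉ xs → Unique xs → Unique (x ∷ xs)
Unique-∷ x∉ u = ¬Any⇒All¬ _ x∉ ∷ u

Unique-resp-↭ : xs ↭ ys → Unique xs → Unique ys
Unique-resp-↭ σ = ↭ₛ.Unique-resp-↭ (setoid _) (↭⇒↭ₛ σ)

Unique-resp-⊇ : xs ⊆ ys → Unique ys → Unique xs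
Unique-resp-⊇ []         []        = []
Unique-resp-⊇ (_ ∷ʳ τ)   (_ ∷ u)   = Unique-resp-⊇ τ u
Unique-resp-⊇ (refl ∷ τ) (x≢ ∷ u)  = All-resp-⊆ τ x≢ ∷ Unique-resp-⊇ τ u

InjectiveOn : Pred A 0ℓ → (A → B) → Set
InjectiveOn P h = ∀ {x y} → P x → P y → h x ≡ h y → x ≡ y

Unique-map⇒InjectiveOn : ∀ {h : A → B} → Unique (map h xs) → InjectiveOn (_∈ xs) h
Unique-map⇒InjectiveOn _         (here refl) (here refl)  _  = refl
Unique-map⇒InjectiveOn {h = h} (hx≢ ∷ _) (here refl) (there y∈) eq = contradiction eq (All.lookup hx≢ (∈-map⁺ h y∈))
Unique-map⇒InjectiveOn {h = h} (hy≢ ∷ _) (there x∈) (here refl) eq = contradiction (sym eq) (All.lookup hy≢ (∈-map⁺ h x∈))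
Unique-map⇒InjectiveOn (_ ∷ u) (there x∈) (there y∈) eq = Unique-map⇒InjectiveOn u x∈ y∈ eq

concat-↭ : {xss yss : List (List A)} → xss ↭ yss → concat xss ↭ concat yss
concat-↭ refl            = refl
concat-↭ (prep xs σ)     = ↭.++⁺ˡ xs (concat-↭ σ)
concat-↭ (swap xs ys σ)  = trans (↭.shifts xs ys) (↭.++⁺ˡ ys (↭.++⁺ˡ xs (concat-↭ σ)))
concat-↭ (trans σ τ)     = trans (concat-↭ σ) (concat-↭ τ)

module _ (_≟ᴬ_ : DecidableEquality A) where

  indexOf : A → List A → ℕ
  indexOf x [] = 0
  indexOf x (y ∷ ys) with x ≟ᴬ y
  ... | yes _ = 0
  ... | no _  = suc (indexOf x ys)

  indexOf-here : ∀ x ys → indexOf x (x ∷ ys) ≡ 0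
  indexOf-here x ys with x ≟ᴬ x
  ... | yes _  = refl
  ... | no x≢x = contradiction refl x≢x

  indexOf-there : ∀ {x y} ys → x ≢ y → indexOf x (y ∷ ys) ≡ suc (indexOf x ys)
  indexOf-there {x} {y} ys x≢y with x ≟ᴬ y
  ... | yes x≡y = contradiction x≡y x≢y
  ... | no _    = refl

  indexOf-consecutive : ∀ xs {x y ys} → Unique (xs ++ x ∷ y ∷ ys) →
    indexOf x (xs ++ x ∷ y ∷ ys) < indexOf y (xs ++ x ∷ y ∷ ys)
  indexOf-consecutive [] {x} {y} {ys} ((x≢y ∷ _) ∷ _) = begin-strict
    indexOf x (x ∷ y ∷ ys)  ≡⟨ indexOf-here x (y ∷ ys) ⟩
    0                       <⟨ s≤s z≤n ⟩
    suc (indexOf y (y ∷ ys)) ≡⟨ sym (indexOf-there (y ∷ ys) (x≢y ∘ sym)) ⟩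
    indexOf y (x ∷ y ∷ ys)  ∎
    where open ℕ.≤-Reasoning
  indexOf-consecutive (z ∷ xs) {x} {y} {ys} (z≢ ∷ u) = begin-strict
    indexOf x (z ∷ zs)      ≡⟨ indexOf-there zs (z≢x ∘ sym) ⟩
    suc (indexOf x zs)      <⟨ s≤s (indexOf-consecutive xs u) ⟩
    suc (indexOf y zs)      ≡⟨ sym (indexOf-there zs (z≢y ∘ sym)) ⟩
    indexOf y (z ∷ zs)      ∎
    where
    open ℕ.≤-Reasoning
    zs : List A
    zs = xs ++ x ∷ y ∷ ys
    z≢x : z ≢ x
    z≢x = All.lookup z≢ (∈-++⁺ʳ xs (here refl))
    z≢y : z ≢ y
    z≢y = All.lookup z≢ (∈-++⁺ʳ xs (there (here refl)))

record IsLinearForest {n m} (G : RawDigraph n m) (P : Pred (Fin m) 0ℓ) : Set where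
  field
    src-injective     : InjectiveOn P (src G)
    tgt-injective     : InjectiveOn P (tgt G)
    height            : Fin n → ℕ
    height-increasing : ∀ {f} → P f → height (src G f) < height (tgt G f)

  loopless : ∀ {f} → P f → src G f ≢ tgt G f
  loopless Pf = ℕ.<⇒≢ (height-increasing Pf) ∘ cong height

IsLinearForest-mono : ∀ {n m} {G : RawDigraph n m} {P Q : Pred (Fin m) 0ℓ} →
  (∀ {f} → Q f → P f) → IsLinearForest G P → IsLinearForest G Q
IsLinearForest-mono Q⊆P F = record
  { src-injective     = λ Qf Qg → src-injective (Q⊆P Qf) (Q⊆P Qg)
  ; tgt-injective     = λ Qf Qg → tgt-injective (Q⊆P Qf) (Q⊆P Qg)
  ; height            = height
  ; height-increasing = height-increasing ∘ Q⊆P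
  }
  where open IsLinearForest F

IsLinearForest-cong : ∀ {n m} {G : RawDigraph n m} {P Q : Pred (Fin m) 0ℓ} →
  (∀ {f} → P f ⇔ Q f) → IsLinearForest G P ⇔ IsLinearForest G Q
IsLinearForest-cong P⇔Q = mk⇔ (IsLinearForest-mono (Equivalence.from P⇔Q)) (IsLinearForest-mono (Equivalence.to P⇔Q))

module PathFamilies {n m} (G : RawDigraph n m) where

  open import Data.List.Membership.DecPropositional (_≟_ {n}) using (_∈?_)

  vertices : List (List (Fin m)) → List (Fin n)
  vertices ps = concat (map (pathVerts G) ps)

  IsPathFamily : List (List (Fin m)) → Set
  IsPathFamily ps = All (IsSimplePath G) ps × Unique (vertices ps)

  linked : ∀ {p} → IsSimplePath G p → Linked (Consecutive G) p
  linked (_ , l , _) = l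

  pathVerts-∷ : ∀ {f g} p → Consecutive G f g →
    pathVerts G (f ∷ g ∷ p) ≡ src G f ∷ pathVerts G (g ∷ p)
  pathVerts-∷ {f} {g} p f→g = cong (λ a → src G f ∷ a ∷ map (tgt G) (g ∷ p)) f→g

  vertices-↭ : ∀ {ps qs} → ps ↭ qs → vertices ps ↭ vertices qs
  vertices-↭ σ = concat-↭ (↭.map⁺ (pathVerts G) σ)

  IsPathFamily-resp-↭ : ∀ {ps qs} → ps ↭ qs → IsPathFamily ps → IsPathFamily qs
  IsPathFamily-resp-↭ σ (simple , uniq) = ↭.All-resp-↭ σ simple , Unique-resp-↭ (vertices-↭ σ) uniq

  sources⊆pathVerts : ∀ {p} → Linked (Consecutive G) p → map (src G) p ⊆ pathVerts G p
  sources⊆pathVerts []                 = []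
  sources⊆pathVerts {f ∷ []} [-]       = refl ∷ (tgt G f ∷ʳ [])
  sources⊆pathVerts {f ∷ g ∷ p} (f→g ∷ l) =
    subst (map (src G) (f ∷ g ∷ p) ⊆_) (sym (pathVerts-∷ p f→g)) (refl ∷ sources⊆pathVerts l)

  targets⊆pathVerts : ∀ {p} → IsSimplePath G p → map (tgt G) p ⊆ pathVerts G p
  targets⊆pathVerts {f ∷ _} _ = src G f ∷ʳ ⊆-refl

  endpoints⊆vertices : ∀ (end : Fin m → Fin n) → (∀ {p} → IsSimplePath G p → map end p ⊆ pathVerts G p) →
    ∀ {ps} → All (IsSimplePath G) ps → map end (concat ps) ⊆ vertices ps
  endpoints⊆vertices end end⊆ []                      = []
  endpoints⊆vertices end end⊆ {p ∷ ps} (sp ∷ simple) =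
    subst (_⊆ vertices (p ∷ ps)) (sym (List.map-++ end p (concat ps)))
      (++⁺ (end⊆ sp) (endpoints⊆vertices end end⊆ simple))

  consecutive-in-pathVerts : ∀ {p f} → Linked (Consecutive G) p → f ∈ p →
    ∃₂ λ as bs → pathVerts G p ≡ as ++ src G f ∷ tgt G f ∷ bs
  consecutive-in-pathVerts {_ ∷ q} _ (here refl) = [] , map (tgt G) q , refl
  consecutive-in-pathVerts {f ∷ g ∷ q} (f→g ∷ l) (there e∈) =
    let as , bs , eq = consecutive-in-pathVerts l e∈
    in src G f ∷ as , bs , ≡.trans (pathVerts-∷ q f→g) (cong (src G f ∷_) eq)

  consecutive-in-vertices : ∀ {ps f} → All (IsSimplePath G) ps → f ∈ concat ps →
    ∃₂ λ as bs → vertices ps ≡ as ++ src G f ∷ tgt G f ∷ bs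
  consecutive-in-vertices {p ∷ ps} {f} (sp ∷ simple) f∈ with ∈-++⁻ p f∈
  ... | inj₁ f∈p =
    let as , bs , eq = consecutive-in-pathVerts (linked sp) f∈p
    in as , bs ++ vertices ps ,
       ≡.trans (cong (_++ vertices ps) eq) (List.++-assoc as (src G f ∷ tgt G f ∷ bs) (vertices ps))
  ... | inj₂ f∈ps =
    let as , bs , eq = consecutive-in-vertices simple f∈ps
    in pathVerts G p ++ as , bs ,
       ≡.trans (cong (pathVerts G p ++_) eq) (sym (List.++-assoc (pathVerts G p) as (src G f ∷ tgt G f ∷ bs)))

  pathFamily⇒linearForest : ∀ {ps} → IsPathFamily ps → IsLinearForest G (_∈ concat ps)
  pathFamily⇒linearForest {ps} (simple , uniq) = record
    { src-injective     = injective (src G) (sources⊆pathVerts ∘ linked)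
    ; tgt-injective     = injective (tgt G) targets⊆pathVerts
    ; height            = height
    ; height-increasing = height-increasing
    }
    where
    injective : ∀ end → (∀ {p} → IsSimplePath G p → map end p ⊆ pathVerts G p) → InjectiveOn (_∈ concat ps) end
    injective end end⊆ = Unique-map⇒InjectiveOn (Unique-resp-⊇ (endpoints⊆vertices end end⊆ simple) uniq)

    height : Fin n → ℕ
    height u = indexOf _≟_ u (vertices ps)

    height-increasing : ∀ {f} → f ∈ concat ps → height (src G f) < height (tgt G f)
    height-increasing {f} f∈ with consecutive-in-vertices simple f∈
    ... | as , bs , eq rewrite eq = indexOf-consecutive _≟_ as uniq

  incident-in-path : ∀ {a} p → a ∈ pathVerts G p → ∃ λ g → g ∈ p × (src G g ≡ a ⊎ tgt G g ≡ a)
  incident-in-path (f ∷ _) (here a≡) = f , here refl , inj₁ (sym a≡)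
  incident-in-path (f ∷ p) (there a∈) with ∈-map⁻ (tgt G) a∈
  ... | g , g∈ , a≡ = g , g∈ , inj₂ (sym a≡)

  incident-edge : ∀ {ps a} → a ∈ vertices ps → ∃ λ g → g ∈ concat ps × (src G g ≡ a ⊎ tgt G g ≡ a)
  incident-edge {ps} a∈ with ∈-concat⁻′ (map (pathVerts G) ps) a∈
  ... | _ , a∈vs , vs∈ with ∈-map⁻ (pathVerts G) vs∈
  ...   | p , p∈ , refl with incident-in-path p a∈vs
  ...     | g , g∈ , incident = g , ∈-concat⁺′ g∈ p∈ , incident

  path-starting-at : ∀ {ps b} → b ∈ vertices ps → (∀ {g} → g ∈ concat ps → tgt G g ≢ b) →
    ∃₂ λ h q → ∃ λ rest → ps ↭ (h ∷ q) ∷ rest × src G h ≡ b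
  path-starting-at {p ∷ ps} b∈ no-in with ∈-++⁻ (pathVerts G p) b∈
  path-starting-at {(h ∷ q) ∷ ps} _ _     | inj₁ (here b≡) = h , q , ps , refl , sym b≡
  path-starting-at {(h ∷ q) ∷ ps} _ no-in | inj₁ (there b∈) with ∈-map⁻ (tgt G) b∈
  ... | g , g∈ , b≡ = contradiction (sym b≡) (no-in (∈-++⁺ˡ g∈))
  path-starting-at {p ∷ ps} _ no-in | inj₂ b∈ with path-starting-at b∈ (no-in ∘ ∈-++⁺ʳ p)
  ... | h , q , rest , σ , h≡ = h , q , p ∷ rest , trans (prep p σ) (swap p _ refl) , h≡

  prepend-edge : ∀ {ps f} → IsPathFamily ps → src G f ∉ vertices ps → src G f ≢ tgt G f →
    (∀ {g} → g ∈ concat ps → tgt G g ≢ tgt G f) →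
    ∃ λ qs → IsPathFamily qs × concat qs ↭ f ∷ concat ps
  prepend-edge {ps} {f} (simple , uniq) s∉ s≢t no-in with tgt G f ∈? vertices ps
  ... | no t∉ = [ f ] ∷ ps , (single ∷ simple , Unique-∷ (s∉t∷ s∉) (Unique-∷ t∉ uniq)) , refl
    where
    s∉t∷ : ∀ {vs} → src G f ∉ vs → src G f ∉ tgt G f ∷ vs
    s∉t∷ _  (here s≡t) = s≢t s≡t
    s∉t∷ s∉ (there s∈) = s∉ s∈
    single : IsSimplePath G [ f ]
    single = s≤s z≤n , [-] , Unique-∷ (s∉t∷ λ ()) (Unique-∷ (λ ()) [])
  ... | yes t∈ with path-starting-at t∈ no-in
  ...   | h , q , rest , σ , h≡ with IsPathFamily-resp-↭ σ (simple , uniq)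
  ...     | (hq-simple ∷ rest-simple) , hq-rest-uniq =
    (f ∷ h ∷ q) ∷ rest , (new-simple ∷ rest-simple , new-uniq) , prep f (concat-↭ (↭-sym σ))
    where
    f→h : Consecutive G f h
    f→h = sym h≡
    s∉′ : src G f ∉ vertices ((h ∷ q) ∷ rest)
    s∉′ = s∉ ∘ ↭.∈-resp-↭ (↭-sym (vertices-↭ σ))
    new-simple : IsSimplePath G (f ∷ h ∷ q)
    new-simple = s≤s z≤n , f→h ∷ linked hq-simple ,
      subst Unique (sym (pathVerts-∷ q f→h)) (Unique-∷ (s∉′ ∘ ∈-++⁺ˡ) (proj₂ (proj₂ hq-simple)))
    new-uniq : Unique (vertices ((f ∷ h ∷ q) ∷ rest))
    new-uniq = subst (λ vs → Unique (vs ++ vertices rest)) (sym (pathVerts-∷ q f→h)) (Unique-∷ s∉′ hq-rest-uniq)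

  module _ {P : Pred (Fin m) 0ℓ} (F : IsLinearForest G P) where
    open IsLinearForest F

    SourceSorted : List (Fin m) → Set
    SourceSorted = AllPairs (λ f g → height (src G f) ≤ height (src G g))

    -- Edges are added in order of decreasing source height, so the source of a
    -- new edge is not yet covered: the edge starts a new path or is prepended
    -- to the path starting at its target.
    pathFamily-from : ∀ L → All P L → Unique L → SourceSorted L →
      ∃ λ ps → IsPathFamily ps × concat ps ↭ L
    pathFamily-from [] _ _ _ = [] , ([] , []) , refl
    pathFamily-from (f ∷ L) (Pf ∷ PL) (f≢L ∷ uniq) (f≤L ∷ sorted) =
      let ps , family , σ = pathFamily-from L PL uniq sorted
          qs , family′ , τ = prepend-edge family (source-fresh {ps} σ) (loopless Pf) (target-fresh {ps} σ)
      in qs , family′ , trans τ (prep f σ)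
      where
      source-fresh : ∀ {ps} → concat ps ↭ L → src G f ∉ vertices ps
      source-fresh {ps} σ s∈ with incident-edge {ps} s∈
      ... | g , g∈ , incident with ↭.∈-resp-↭ σ g∈ | incident
      ...   | g∈L | inj₁ sg≡sf = All.lookup f≢L g∈L (src-injective Pf (All.lookup PL g∈L) (sym sg≡sf))
      ...   | g∈L | inj₂ tg≡sf = ℕ.<⇒≱
        (subst (λ u → height (src G g) < height u) tg≡sf (height-increasing (All.lookup PL g∈L)))
        (All.lookup f≤L g∈L)

      target-fresh : ∀ {ps} → concat ps ↭ L → ∀ {g} → g ∈ concat ps → tgt G g ≢ tgt G f
      target-fresh σ g∈ tg≡tf with ↭.∈-resp-↭ σ g∈
      ... | g∈L = All.lookup f≢L g∈L (tgt-injective Pf (All.lookup PL g∈L) (sym tg≡tf))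

  linearForest⇒multipath : ∀ {S} → IsLinearForest G (_∈ₛ S) → IsMultipath G S
  linearForest⇒multipath {S} F =
    let ps , (simple , uniq) , σ = pathFamily-from F L (All.tabulate (proj₂ ∘ members)) L-unique L-sorted
    in ps , simple , uniq , λ f → mk⇔ (↭.∈-resp-↭ (↭-sym σ) ∘ L⁺) (proj₂ ∘ members ∘ ↭.∈-resp-↭ σ)
    where
    open IsLinearForest F using (height)
    open Sort (On.decTotalOrder ℕ.≤-decTotalOrder (height ∘ src G)) using (sort; sort-↭; sort-↗)
    S-list : List (Fin m)
    S-list = filter (Subset._∈? S) (allFin m)
    L : List (Fin m)
    L = sort S-list
    members : ∀ {f} → f ∈ L → f ∈ allFin m × f ∈ₛ S
    members = ∈-filter⁻ (Subset._∈? S) ∘ ↭.∈-resp-↭ (sort-↭ S-list)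
    L⁺ : ∀ {f} → f ∈ₛ S → f ∈ L
    L⁺ {f} f∈S = ↭.∈-resp-↭ (↭-sym (sort-↭ S-list)) (∈-filter⁺ (Subset._∈? S) (∈-allFin f) f∈S)
    L-unique : Unique L
    L-unique = Unique-resp-↭ (↭-sym (sort-↭ S-list)) (Unique.filter⁺ (Subset._∈? S) (Unique.allFin⁺ m))
    L-sorted : SourceSorted F L
    L-sorted = Linked⇒AllPairs ℕ.≤-trans (sort-↗ S-list)

  multipath⇒linearForest : ∀ {S} → IsMultipath G S → IsLinearForest G (_∈ₛ S)
  multipath⇒linearForest (ps , simple , uniq , S⇔ps) =
    IsLinearForest-mono (Equivalence.to (S⇔ps _)) (pathFamily⇒linearForest (simple , uniq))

  multipath⇔linearForest : ∀ S → IsMultipath G S ⇔ IsLinearForest G (_∈ₛ S)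
  multipath⇔linearForest S = mk⇔ multipath⇒linearForest linearForest⇒multipath

open PathFamilies using (multipath⇔linearForest)

data PunchInView {m} (e : Fin (suc m)) : Fin (suc m) → Set where
  at-e    : PunchInView e e
  punched : ∀ f → PunchInView e (punchIn e f)

punchInView : ∀ {m} (e g : Fin (suc m)) → PunchInView e g
punchInView e g with e ≟ g
... | yes refl = at-e
... | no e≢g   = subst (PunchInView e) (Fin.punchIn-punchOut e≢g) (punched (punchOut e≢g))

InjectiveOn-punchIn : ∀ {m k} {e : Fin (suc m)} {P : Pred (Fin (suc m)) 0ℓ} (end : Fin (suc m) → Fin k) →
  (∀ {f} → P e → P (punchIn e f) → end (punchIn e f) ≢ end e) →
  InjectiveOn (P ∘ punchIn e) (end ∘ punchIn e) → InjectiveOn P end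
InjectiveOn-punchIn {e = e} end avoids injective {g₁} {g₂} P₁ P₂ eq with punchInView e g₁ | punchInView e g₂
... | at-e       | at-e       = refl
... | at-e       | punched _  = contradiction (sym eq) (avoids P₁ P₂)
... | punched _  | at-e       = contradiction eq (avoids P₂ P₁)
... | punched f₁ | punched f₂ = cong (punchIn e) (injective P₁ P₂ eq)

punchIn∈insertAt : ∀ {m} (I : Subset m) e b {f} → punchIn e f ∈ₛ insertAt I e b ⇔ f ∈ₛ I
punchIn∈insertAt I e b {f} = mk⇔
  (λ f∈ → Vec.lookup⇒[]= f I (≡.trans (sym (Vec.insertAt-punchIn I e b f)) (Vec.[]=⇒lookup f∈)))
  (λ f∈ → Vec.lookup⇒[]= (punchIn e f) (insertAt I e b) (≡.trans (Vec.insertAt-punchIn I e b f) (Vec.[]=⇒lookup f∈)))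

∈insertAt-inside : ∀ {m} (I : Subset m) e → e ∈ₛ insertAt I e inside
∈insertAt-inside I e = Vec.lookup⇒[]= e (insertAt I e inside) (Vec.insertAt-lookup I e inside)

∉insertAt-outside : ∀ {m} (I : Subset m) e → e ∉ₛ insertAt I e outside
∉insertAt-outside I e e∈ with ≡.trans (sym (Vec.insertAt-lookup I e outside)) (Vec.[]=⇒lookup e∈)
... | ()

module _ {n m} (G : RawDigraph n (suc m)) (e : Fin (suc m)) where

  linearForest⇒deleteEdge : ∀ {P : Pred (Fin (suc m)) 0ℓ} →
    IsLinearForest G P → IsLinearForest (deleteEdge G e) (P ∘ punchIn e)
  linearForest⇒deleteEdge F = record
    { src-injective     = λ P₁ P₂ → Fin.punchIn-injective e _ _ ∘ src-injective P₁ P₂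
    ; tgt-injective     = λ P₁ P₂ → Fin.punchIn-injective e _ _ ∘ tgt-injective P₁ P₂
    ; height            = height
    ; height-increasing = height-increasing
    }
    where open IsLinearForest F

  deleteEdge⇒linearForest : ∀ {P : Pred (Fin (suc m)) 0ℓ} → ¬ P e →
    IsLinearForest (deleteEdge G e) (P ∘ punchIn e) → IsLinearForest G P
  deleteEdge⇒linearForest {P} ¬Pe F = record
    { src-injective     = InjectiveOn-punchIn (src G) (λ Pe → contradiction Pe ¬Pe) src-injective
    ; tgt-injective     = InjectiveOn-punchIn (tgt G) (λ Pe → contradiction Pe ¬Pe) tgt-injective
    ; height            = height
    ; height-increasing = increasing
    }
    where
    open IsLinearForest F
    increasing : ∀ {g} → P g → height (src G g) < height (tgt G g)
    increasing {g} Pg with punchInView e g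
    ... | at-e      = contradiction Pg ¬Pe
    ... | punched f = height-increasing Pg

  multipath-deleteEdge : ∀ I → IsMultipath (deleteEdge G e) I ⇔ IsMultipath G (insertAt I e outside)
  multipath-deleteEdge I = begin
    IsMultipath (deleteEdge G e) I
      ≈⟨ multipath⇔linearForest (deleteEdge G e) I ⟩
    IsLinearForest (deleteEdge G e) (_∈ₛ I)
      ≈⟨ IsLinearForest-cong (⇔.sym (punchIn∈insertAt I e outside)) ⟩
    IsLinearForest (deleteEdge G e) ((_∈ₛ insertAt I e outside) ∘ punchIn e)
      ≈⟨ mk⇔ (deleteEdge⇒linearForest (∉insertAt-outside I e)) linearForest⇒deleteEdge ⟩
    IsLinearForest G (_∈ₛ insertAt I e outside)
      ≈⟨ ⇔.sym (multipath⇔linearForest G _) ⟩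
    IsMultipath G (insertAt I e outside) ∎
    where open SetoidReasoning (⇔.⇔-setoid 0ℓ)

module _ {n m} (G : RawDigraph (suc n) (suc m)) (e : Fin (suc m)) (v≢w : src G e ≢ tgt G e) where
  private
    v w : Fin (suc n)
    v = src G e
    w = tgt G e
    merge : Fin (suc n) → Fin n
    merge = mergeV v w v≢w
    G/e : RawDigraph n m
    G/e = contractEdge G e v≢w

  merge-v : merge v ≡ punchOut v≢w
  merge-v with v ≟ v
  ... | yes _   = refl
  ... | no v≢v  = contradiction refl v≢v

  merge-w : merge w ≡ punchOut v≢w
  merge-w with v ≟ w
  ... | yes v≡w = contradiction v≡w v≢w
  ... | no _    = Fin.punchOut-cong v refl

  punchIn-merge : ∀ {u} → u ≢ v → punchIn v (merge u) ≡ u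
  punchIn-merge {u} u≢v with v ≟ u
  ... | yes v≡u = contradiction (sym v≡u) u≢v
  ... | no v≢u  = Fin.punchIn-punchOut v≢u

  punchIn-merge-v : punchIn v (merge v) ≡ w
  punchIn-merge-v = ≡.trans (cong (punchIn v) merge-v) (Fin.punchIn-punchOut v≢w)

  merge-injective-≢v : InjectiveOn (_≢ v) merge
  merge-injective-≢v a≢v b≢v eq =
    ≡.trans (sym (punchIn-merge a≢v)) (≡.trans (cong (punchIn v) eq) (punchIn-merge b≢v))

  merge-injective-≢w : InjectiveOn (_≢ w) merge
  merge-injective-≢w {a} {b} a≢w b≢w eq with a ≟ v | b ≟ v
  ... | yes a≡v | yes b≡v = ≡.trans a≡v (sym b≡v)
  ... | yes refl | no b≢v =
    contradiction (≡.trans (sym (punchIn-merge b≢v)) (≡.trans (cong (punchIn v) (sym eq)) punchIn-merge-v)) b≢w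
  ... | no a≢v | yes refl =
    contradiction (≡.trans (sym (punchIn-merge a≢v)) (≡.trans (cong (punchIn v) eq) punchIn-merge-v)) a≢w
  ... | no a≢v | no b≢v = merge-injective-≢v a≢v b≢v eq

  contracted-loop : ∀ f → src G (punchIn e f) ≡ v ⊎ tgt G (punchIn e f) ≡ w → src G/e f ≡ tgt G/e f
  contracted-loop f touches with src G (punchIn e f) ≟ v | tgt G (punchIn e f) ≟ w | touches
  ... | yes _ | _     | _        = refl
  ... | no _  | yes _ | _        = refl
  ... | no s≢v | no _ | inj₁ s≡v = contradiction s≡v s≢v
  ... | no _  | no t≢w | inj₂ t≡w = contradiction t≡w t≢w

  Survives : Fin (suc m) → Set
  Survives g = src G g ≢ v × tgt G g ≢ w

  contracted-endpoints : ∀ f → Survives (punchIn e f) →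
    src G/e f ≡ merge (src G (punchIn e f)) × tgt G/e f ≡ merge (tgt G (punchIn e f))
  contracted-endpoints f (s≢v , t≢w) with src G (punchIn e f) ≟ v | tgt G (punchIn e f) ≟ w
  ... | yes s≡v | _       = contradiction s≡v s≢v
  ... | no _    | yes t≡w = contradiction t≡w t≢w
  ... | no _    | no _    = refl , refl

  pullback-height : (Fin n → ℕ) → Fin (suc n) → ℕ
  pullback-height h u with u ≟ w
  ... | yes _ = suc (2 * h (merge u))
  ... | no _  = 2 * h (merge u)

  pullback-height-increasing : ∀ h {a b} → h (merge a) < h (merge b) → pullback-height h a < pullback-height h b
  pullback-height-increasing h {a} {b} ha<hb = begin-strict
    pullback-height h a      ≤⟨ upper a ⟩
    suc (2 * h (merge a))    <⟨ subst (_≤ 2 * h (merge b)) (ℕ.*-suc 2 (h (merge a))) (ℕ.*-monoʳ-≤ 2 ha<hb) ⟩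
    2 * h (merge b)          ≤⟨ lower b ⟩
    pullback-height h b      ∎
    where
    open ℕ.≤-Reasoning
    upper : ∀ u → pullback-height h u ≤ suc (2 * h (merge u))
    upper u with u ≟ w
    ... | yes _ = ℕ.≤-refl
    ... | no _  = ℕ.n≤1+n _
    lower : ∀ u → 2 * h (merge u) ≤ pullback-height h u
    lower u with u ≟ w
    ... | yes _ = ℕ.n≤1+n _
    ... | no _  = ℕ.≤-refl

  pullback-height-v<w : ∀ h → pullback-height h v < pullback-height h w
  pullback-height-v<w h with v ≟ w | w ≟ w
  ... | yes v≡w | _      = contradiction v≡w v≢w
  ... | no _    | no w≢w = contradiction refl w≢w
  ... | no _    | yes _  = subst (λ y → 2 * h (merge v) < suc (2 * h y)) (≡.trans merge-v (sym merge-w)) ℕ.≤-refl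

  linearForest⇒contractEdge : ∀ {P : Pred (Fin (suc m)) 0ℓ} → P e →
    IsLinearForest G P → IsLinearForest G/e (P ∘ punchIn e)
  linearForest⇒contractEdge {P} Pe F = record
    { src-injective     = λ {f₁} {f₂} P₁ P₂ eq → Fin.punchIn-injective e f₁ f₂ (src-injective P₁ P₂
        (merge-injective-≢v (proj₁ (survives P₁)) (proj₁ (survives P₂))
          (≡.trans (sym (proj₁ (endpoints P₁))) (≡.trans eq (proj₁ (endpoints P₂))))))
    ; tgt-injective     = λ {f₁} {f₂} P₁ P₂ eq → Fin.punchIn-injective e f₁ f₂ (tgt-injective P₁ P₂
        (merge-injective-≢w (proj₂ (survives P₁)) (proj₂ (survives P₂))
          (≡.trans (sym (proj₂ (endpoints P₁))) (≡.trans eq (proj₂ (endpoints P₂))))))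
    ; height            = height ∘ punchIn v
    ; height-increasing = increasing
    }
    where
    open IsLinearForest F
    survives : ∀ {f} → P (punchIn e f) → Survives (punchIn e f)
    survives {f} Pf = Fin.punchInᵢ≢i e f ∘ src-injective Pf Pe , Fin.punchInᵢ≢i e f ∘ tgt-injective Pf Pe
    endpoints : ∀ {f} → P (punchIn e f) →
      src G/e f ≡ merge (src G (punchIn e f)) × tgt G/e f ≡ merge (tgt G (punchIn e f))
    endpoints Pf = contracted-endpoints _ (survives Pf)
    height≤ : ∀ u → height u ≤ height (punchIn v (merge u))
    height≤ u with u ≟ v
    ... | yes refl = subst (λ y → height v ≤ height y) (sym punchIn-merge-v) (ℕ.<⇒≤ (height-increasing Pe))
    ... | no u≢v   = ℕ.≤-reflexive (cong height (sym (punchIn-merge u≢v)))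
    increasing : ∀ {f} → P (punchIn e f) → height (punchIn v (src G/e f)) < height (punchIn v (tgt G/e f))
    increasing {f} Pf = begin-strict
      height (punchIn v (src G/e f))        ≡⟨ cong (height ∘ punchIn v) (proj₁ (endpoints Pf)) ⟩
      height (punchIn v (merge (src G g)))  ≡⟨ cong height (punchIn-merge (proj₁ (survives Pf))) ⟩
      height (src G g)                      <⟨ height-increasing Pf ⟩
      height (tgt G g)                      ≤⟨ height≤ (tgt G g) ⟩
      height (punchIn v (merge (tgt G g)))  ≡⟨ cong (height ∘ punchIn v) (sym (proj₂ (endpoints Pf))) ⟩
      height (punchIn v (tgt G/e f))        ∎
      where
      open ℕ.≤-Reasoning
      g : Fin (suc m)
      g = punchIn e f

  contractEdge⇒linearForest : ∀ {P : Pred (Fin (suc m)) 0ℓ} →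
    IsLinearForest G/e (P ∘ punchIn e) → IsLinearForest G P
  contractEdge⇒linearForest {P} F = record
    { src-injective     = InjectiveOn-punchIn (src G) (λ _ Pf → proj₁ (survives Pf)) λ P₁ P₂ eq →
        src-injective P₁ P₂ (≡.trans (proj₁ (endpoints P₁)) (≡.trans (cong merge eq) (sym (proj₁ (endpoints P₂)))))
    ; tgt-injective     = InjectiveOn-punchIn (tgt G) (λ _ Pf → proj₂ (survives Pf)) λ P₁ P₂ eq →
        tgt-injective P₁ P₂ (≡.trans (proj₂ (endpoints P₁)) (≡.trans (cong merge eq) (sym (proj₂ (endpoints P₂)))))
    ; height            = pullback-height height
    ; height-increasing = increasing
    }
    where
    open IsLinearForest F
    survives : ∀ {f} → P (punchIn e f) → Survives (punchIn e f)
    survives {f} Pf = loopless Pf ∘ contracted-loop f ∘ inj₁ , loopless Pf ∘ contracted-loop f ∘ inj₂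
    endpoints : ∀ {f} → P (punchIn e f) →
      src G/e f ≡ merge (src G (punchIn e f)) × tgt G/e f ≡ merge (tgt G (punchIn e f))
    endpoints Pf = contracted-endpoints _ (survives Pf)
    increasing : ∀ {g} → P g → pullback-height height (src G g) < pullback-height height (tgt G g)
    increasing {g} Pg with punchInView e g
    ... | at-e      = pullback-height-v<w height
    ... | punched f = pullback-height-increasing height
      (≡.subst₂ _<_ (cong height (proj₁ (endpoints Pg))) (cong height (proj₂ (endpoints Pg))) (height-increasing Pg))

  multipath-contractEdge : ∀ I → IsMultipath G/e I ⇔ IsMultipath G (insertAt I e inside)
  multipath-contractEdge I = begin
    IsMultipath G/e I
      ≈⟨ multipath⇔linearForest G/e I ⟩
    IsLinearForest G/e (_∈ₛ I)
      ≈⟨ IsLinearForest-cong (⇔.sym (punchIn∈insertAt I e inside)) ⟩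
    IsLinearForest G/e ((_∈ₛ insertAt I e inside) ∘ punchIn e)
      ≈⟨ mk⇔ contractEdge⇒linearForest (linearForest⇒contractEdge (∈insertAt-inside I e)) ⟩
    IsLinearForest G (_∈ₛ insertAt I e inside)
      ≈⟨ ⇔.sym (multipath⇔linearForest G _) ⟩
    IsMultipath G (insertAt I e inside) ∎
    where open SetoidReasoning (⇔.⇔-setoid 0ℓ)

proposition5p4 : ∀ {n m} (G : RawDigraph (suc n) (suc m)) → IsMPDigraph G →
    (e : Fin (suc m)) → (nl : src G e ≢ tgt G e) →
    (MultMatroid (deleteEdge G e) ≈ₘ (MultMatroid G ∖ₘ e)) ×
    (MultMatroid (contractEdge G e nl) ≈ₘ (MultMatroid G /ₘ e))
proposition5p4 G _ e nl = multipath-deleteEdge G e , multipath-contractEdge G e nl
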